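{- Let $d \equiv 2 \pmod 4$ be a square-free integer. Assume that the ring $\mathbb{Z}[\sqrt{d}]$ contains an element of norm $-1$ and an element of norm $6$. Then $\mathbb{Z}[\sqrt{d}]$ contains no element of norm $2$ and no element of norm $-2$.
   Context: The norm of $x + y\sqrt{d} \in \mathbb{Z}[\sqrt{d}]$ (with $x, y \in \mathbb{Z}$) is $x^2 - dy^2$. -}

module Defs where

open import Data.Integer using (ℤ; _+_; _*_; _-_; ∣_∣; +_; -_)
open import Data.Integer.Divisibility using (_∣_)
open import Data.Nat using (ℕ)
open import Data.Product using (∃)
open import Relation.Binary.PropositionalEquality using (_≡_)

norm : ℤ → ℤ → ℤ → ℤ
norm d x y = x * x - d * (y * y)

SquareFree : ℤ → Set
SquareFree d = ∀ (n : ℤ) → (n * n) ∣ d → ∣ n ∣ ≡ 1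

Cong2mod4 : ℤ → Set
Cong2mod4 d = ∃ λ (k : ℤ) → d ≡ + 4 * k + + 2

HasNorm : ℤ → ℤ → Set
HasNorm d m = ∃ λ (x : ℤ) → ∃ λ (y : ℤ) → norm d x y ≡ m

-- A norm −1 forces d ≡ 2 (mod 8), and modulo 8 the form x² − 2y² takes neither of
-- the values ±3. If x + y√d has norm 6 and a + b√d has norm 2c (c = ±1), then x and a
-- are even because d is, so (x + y√d)(a − b√d) = 2(u + v√d) and u + v√d has norm
-- 6·2c/4 = 3c = ±3, which is impossible.
module Submission where

open import Defs
open import Data.Integer using (ℤ; +_; -_; _+_; _*_; _-_; ∣_∣; _%ℕ_; _/ℕ_)
open import Data.Integer.DivMod using (n%ℕd<d; a≡a%ℕn+[a/ℕn]*n)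
open import Data.Integer.Divisibility.Signed
  using (_∣_; divides; ∣ᵤ⇒∣; ∣⇒∣ᵤ; ∣-trans; ∣-refl; _∣?_; ∣m∣n⇒∣m+n; ∣m∣n⇒∣m-n; ∣m⇒∣-m; ∣m⇒∣m*n; ∣n⇒∣m*n)
open import Data.Integer.Properties using (*-cancelˡ-≡; abs-*)
open import Data.Integer.Tactic.RingSolver using (solve-∀)
open import Data.Nat as ℕ using (ℕ)
import Data.Nat.Divisibility as ℕ
open import Data.Nat.Primality using (euclidsLemma; prime[2])
open import Data.Fin using (Fin; toℕ; fromℕ<)
open import Data.Fin.Properties using (all?; toℕ-fromℕ<)
open import Data.Product using (_×_; _,_; proj₁; proj₂)
open import Data.Sum using ([_,_]′)
open import Function using (_∘_)
open import Relation.Nullary using (¬_; Dec)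
open import Relation.Nullary.Decidable using (toWitness; map′; _→-dec_; ¬?; _×-dec_)
open import Relation.Binary.PropositionalEquality using (_≡_; refl; sym; trans; cong; subst; module ≡-Reasoning)

infix 4 _≡_mod_ _≡?_mod_
record _≡_mod_ (a b m : ℤ) : Set where
  constructor mk
  field divides-difference : m ∣ a - b
open _≡_mod_

_≡?_mod_ : ∀ a b m → Dec (a ≡ b mod m)
a ≡? b mod m = map′ mk divides-difference (m ∣? a - b)

≡-mod-reflexive : ∀ {a b m} → a ≡ b → a ≡ b mod m
≡-mod-reflexive {a} {m = m} refl = mk (divides (+ 0) (a-a≡0*m a m))
  where
  a-a≡0*m : ∀ a m → a - a ≡ + 0 * m
  a-a≡0*m = solve-∀

≡-mod-sym : ∀ {a b m} → a ≡ b mod m → b ≡ a mod m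
≡-mod-sym {a} {b} (mk m∣a-b) = mk (subst (_ ∣_) (b-a≡-[a-b] a b) (∣m⇒∣-m m∣a-b))
  where
  b-a≡-[a-b] : ∀ a b → - (a - b) ≡ b - a
  b-a≡-[a-b] = solve-∀

≡-mod-trans : ∀ {a b c m} → a ≡ b mod m → b ≡ c mod m → a ≡ c mod m
≡-mod-trans {a} {b} {c} (mk m∣a-b) (mk m∣b-c) =
  mk (subst (_ ∣_) (telescope a b c) (∣m∣n⇒∣m+n m∣a-b m∣b-c))
  where
  telescope : ∀ a b c → (a - b) + (b - c) ≡ a - c
  telescope = solve-∀

≡-mod-- : ∀ {a b c e m} → a ≡ b mod m → c ≡ e mod m → a - c ≡ b - e mod m
≡-mod-- {a} {b} {c} {e} (mk m∣a-b) (mk m∣c-e) =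
  mk (subst (_ ∣_) (regroup a b c e) (∣m∣n⇒∣m-n m∣a-b m∣c-e))
  where
  regroup : ∀ a b c e → (a - b) - (c - e) ≡ (a - c) - (b - e)
  regroup = solve-∀

≡-mod-* : ∀ {a b c e m} → a ≡ b mod m → c ≡ e mod m → a * c ≡ b * e mod m
≡-mod-* {a} {b} {c} {e} (mk m∣a-b) (mk m∣c-e) =
  mk (subst (_ ∣_) (regroup a b c e) (∣m∣n⇒∣m+n (∣m⇒∣m*n c m∣a-b) (∣n⇒∣m*n b m∣c-e)))
  where
  regroup : ∀ a b c e → (a - b) * c + b * (c - e) ≡ a * c - b * e
  regroup = solve-∀

≡-mod-weaken : ∀ {a b m n} → n ∣ m → a ≡ b mod m → a ≡ b mod n
≡-mod-weaken n∣m (mk m∣a-b) = mk (∣-trans n∣m m∣a-b)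

a-b+b≡a : ∀ a b → (a - b) + b ≡ a
a-b+b≡a = solve-∀

≡-mod-∣ : ∀ {a b m} → a ≡ b mod m → m ∣ b → m ∣ a
≡-mod-∣ {a} {b} (mk m∣a-b) m∣b = subst (_ ∣_) (a-b+b≡a a b) (∣m∣n⇒∣m+n m∣a-b m∣b)

norm-≡-mod : ∀ {d x y d′ x′ y′ m} → d ≡ d′ mod m → x ≡ x′ mod m → y ≡ y′ mod m →
  norm d x y ≡ norm d′ x′ y′ mod m
norm-≡-mod d≡d′ x≡x′ y≡y′ = ≡-mod-- (≡-mod-* x≡x′ x≡x′) (≡-mod-* d≡d′ (≡-mod-* y≡y′ y≡y′))

⌜_⌝ : ∀ {n} → Fin n → ℤ
⌜_⌝ = +_ ∘ toℕ

residue : (n : ℕ) .{{_ : ℕ.NonZero n}} → ℤ → Fin n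
residue n a = fromℕ< (n%ℕd<d a n)

≡-mod-residue : ∀ n .{{_ : ℕ.NonZero n}} a → a ≡ ⌜ residue n a ⌝ mod + n
≡-mod-residue n a = mk (divides (a /ℕ n) (begin
  a - ⌜ residue n a ⌝           ≡⟨ cong (λ r → a - + r) (toℕ-fromℕ< (n%ℕd<d a n)) ⟩
  a - + (a %ℕ n)                ≡⟨ cong (_- + (a %ℕ n)) (a≡a%ℕn+[a/ℕn]*n a n) ⟩
  (+ (a %ℕ n) + (a /ℕ n) * + n) - + (a %ℕ n) ≡⟨ cancel (+ (a %ℕ n)) ((a /ℕ n) * + n) ⟩
  (a /ℕ n) * + n                ∎))
  where
  open ≡-Reasoning
  cancel : ∀ r q → (r + q) - r ≡ q
  cancel = solve-∀

norm-≡-mod-residues : ∀ n .{{_ : ℕ.NonZero n}} {d D} x y → d ≡ D mod + n →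
  norm d x y ≡ norm D ⌜ residue n x ⌝ ⌜ residue n y ⌝ mod + n
norm-≡-mod-residues n x y d≡D = norm-≡-mod d≡D (≡-mod-residue n x) (≡-mod-residue n y)

2∣x*x⇒2∣x : ∀ x → + 2 ∣ x * x → + 2 ∣ x
2∣x*x⇒2∣x x 2∣x*x = [ ∣ᵤ⇒∣ , ∣ᵤ⇒∣ ]′ (euclidsLemma ∣ x ∣ ∣ x ∣ prime[2] 2∣∣x∣*∣x∣)
  where
  2∣∣x∣*∣x∣ : 2 ℕ.∣ ∣ x ∣ ℕ.* ∣ x ∣
  2∣∣x∣*∣x∣ = subst (2 ℕ.∣_) (abs-* x x) (∣⇒∣ᵤ 2∣x*x)

even-norm⇒even : ∀ {d} x y → + 2 ∣ d → + 2 ∣ norm d x y → + 2 ∣ x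
even-norm⇒even {d} x y 2∣d 2∣n = 2∣x*x⇒2∣x x
  (subst (_ ∣_) (a-b+b≡a (x * x) (d * (y * y))) (∣m∣n⇒∣m+n 2∣n (∣m⇒∣m*n (y * y) 2∣d)))

-- For even d, the product (2x + y√d)(2a − b√d) is 2(u + v√d) with u, v below.
norm-*-of-even : ∀ e x y a b →
  norm (e * + 2) (x * + 2) y * norm (e * + 2) (a * + 2) b ≡
  + 4 * norm (e * + 2) (+ 2 * x * a - e * y * b) (y * a - x * b)
norm-*-of-even = identity
  where
  identity : ∀ e x y a b →
    ((x * + 2) * (x * + 2) - (e * + 2) * (y * y)) * ((a * + 2) * (a * + 2) - (e * + 2) * (b * b)) ≡
    + 4 * ((+ 2 * x * a - e * y * b) * (+ 2 * x * a - e * y * b) - (e * + 2) * ((y * a - x * b) * (y * a - x * b)))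
  identity = solve-∀

norm-6∧norm-2c⇒norm-3c : ∀ {d c} → + 2 ∣ d → HasNorm d (+ 6) → HasNorm d (+ 2 * c) → HasNorm d (+ 3 * c)
norm-6∧norm-2c⇒norm-3c {d} {c} 2∣d (x , y , n≡6) (a , b , n≡2c)
  with 2∣d | even-norm⇒even x y 2∣d (subst (_ ∣_) (sym n≡6) (divides (+ 3) refl))
     | even-norm⇒even a b 2∣d (subst (_ ∣_) (sym n≡2c) (∣m⇒∣m*n c ∣-refl))
... | divides e refl | divides x′ refl | divides a′ refl =
  u , v , *-cancelˡ-≡ (+ 4) (norm d u v) (+ 3 * c) (begin
    + 4 * norm d u v                                  ≡⟨ sym (norm-*-of-even e x′ y a′ b) ⟩
    norm d (x′ * + 2) y * norm d (a′ * + 2) b         ≡⟨ cong (_* _) n≡6 ⟩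
    + 6 * norm d (a′ * + 2) b                         ≡⟨ cong (+ 6 *_) n≡2c ⟩
    + 6 * (+ 2 * c)                                   ≡⟨ twelve c ⟩
    + 4 * (+ 3 * c)                                   ∎)
  where
  open ≡-Reasoning
  u v : ℤ
  u = + 2 * x′ * a′ - e * y * b
  v = y * a′ - x′ * b
  twelve : ∀ c → + 6 * (+ 2 * c) ≡ + 4 * (+ 3 * c)
  twelve = solve-∀

norm-≡-1-residues : ∀ (D X Y : Fin 8) → ⌜ D ⌝ ≡ + 2 mod + 4 →
  norm ⌜ D ⌝ ⌜ X ⌝ ⌜ Y ⌝ ≡ - + 1 mod + 8 → ⌜ D ⌝ ≡ + 2 mod + 8
norm-≡-1-residues = toWitness {a? = all? λ D → all? λ X → all? λ Y →
  (⌜ D ⌝ ≡? + 2 mod + 4) →-dec ((norm ⌜ D ⌝ ⌜ X ⌝ ⌜ Y ⌝ ≡? - + 1 mod + 8) →-dec (⌜ D ⌝ ≡? + 2 mod + 8))} _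

norm-≡-1⇒≡2mod8 : ∀ {d} x y → d ≡ + 2 mod + 4 → norm d x y ≡ - + 1 → d ≡ + 2 mod + 8
norm-≡-1⇒≡2mod8 {d} x y d≡2mod4 n≡-1 = ≡-mod-trans d≡D (norm-≡-1-residues D X Y D≡2mod4 N≡-1)
  where
  D X Y : Fin 8
  D = residue 8 d
  X = residue 8 x
  Y = residue 8 y
  d≡D : d ≡ ⌜ D ⌝ mod + 8
  d≡D = ≡-mod-residue 8 d
  D≡2mod4 : ⌜ D ⌝ ≡ + 2 mod + 4
  D≡2mod4 = ≡-mod-trans (≡-mod-weaken (divides (+ 2) refl) (≡-mod-sym d≡D)) d≡2mod4
  N≡-1 : norm ⌜ D ⌝ ⌜ X ⌝ ⌜ Y ⌝ ≡ - + 1 mod + 8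
  N≡-1 = ≡-mod-trans (≡-mod-sym (norm-≡-mod-residues 8 x y d≡D)) (≡-mod-reflexive n≡-1)

norm-≢±3-residues : ∀ (X Y : Fin 8) →
  ¬ norm (+ 2) ⌜ X ⌝ ⌜ Y ⌝ ≡ + 3 mod + 8 × ¬ norm (+ 2) ⌜ X ⌝ ⌜ Y ⌝ ≡ - + 3 mod + 8
norm-≢±3-residues = toWitness {a? = all? λ X → all? λ Y →
  ¬? (norm (+ 2) ⌜ X ⌝ ⌜ Y ⌝ ≡? + 3 mod + 8) ×-dec ¬? (norm (+ 2) ⌜ X ⌝ ⌜ Y ⌝ ≡? - + 3 mod + 8)} _

no-norm-±3 : ∀ {d} → d ≡ + 2 mod + 8 → ¬ HasNorm d (+ 3) × ¬ HasNorm d (- + 3)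
no-norm-±3 {d} d≡2 = not-norm (λ X Y → proj₁ (norm-≢±3-residues X Y))
                   , not-norm (λ X Y → proj₂ (norm-≢±3-residues X Y))
  where
  not-norm : ∀ {c} → (∀ X Y → ¬ norm (+ 2) ⌜ X ⌝ ⌜ Y ⌝ ≡ c mod + 8) → ¬ HasNorm d c
  not-norm {c} ¬N≡c (x , y , n≡c) = ¬N≡c (residue 8 x) (residue 8 y)
    (≡-mod-trans (≡-mod-sym (norm-≡-mod-residues 8 x y d≡2)) (≡-mod-reflexive n≡c))

lemma5p1 : (d : ℤ) → Cong2mod4 d → SquareFree d →
    HasNorm d (- + 1) → HasNorm d (+ 6) →
    ¬ HasNorm d (+ 2) × ¬ HasNorm d (- + 2)
lemma5p1 d (k , d≡4k+2) _ (x , y , n≡-1) has6 = ¬2c (+ 1) (proj₁ ¬±3) , ¬2c (- + 1) (proj₂ ¬±3)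
  where
  d≡2mod4 : d ≡ + 2 mod + 4
  d≡2mod4 = mk (divides k (trans (cong (_- + 2) d≡4k+2) (shift k)))
    where
    shift : ∀ k → (+ 4 * k + + 2) - + 2 ≡ k * + 4
    shift = solve-∀
  2∣d : + 2 ∣ d
  2∣d = ≡-mod-∣ (≡-mod-weaken (divides (+ 2) refl) d≡2mod4) (divides (+ 1) refl)
  ¬±3 : ¬ HasNorm d (+ 3) × ¬ HasNorm d (- + 3)
  ¬±3 = no-norm-±3 (norm-≡-1⇒≡2mod8 x y d≡2mod4 n≡-1)
  ¬2c : ∀ c → ¬ HasNorm d (+ 3 * c) → ¬ HasNorm d (+ 2 * c)
  ¬2c _ ¬3c = ¬3c ∘ norm-6∧norm-2c⇒norm-3c 2∣d has6
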